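{- The CN calculus is incomplete for epistemic weight models: there is a formula of $\mathcal{L}_{CN}$ that is true at every world of every epistemic weight model but is not derivable in the CN calculus.
   Context: Fix a set $P$ of proposition letters and a finite set $Ag$ of agents. The language $\mathcal{L}_{CN}$ is given by $\phi::=\top\mid p\mid\neg\phi\mid(\phi\wedge\phi)\mid B_a(\phi,\phi)$ with $p\in P$, $a\in Ag$. $\bot,\vee,\to,\leftrightarrow$ are defined as usual; $K_a\phi$ abbreviates $\neg B_a(\neg\phi,\top)$ and $\check K_a\phi$ abbreviates $\neg K_a\neg\phi$. An epistemic weight model is $\mathfrak{M}=(W,R,L,V)$ where $W$ is a non-empty countable set, $R$ assigns to each $a\in Ag$ an equivalence relation $\sim_a$ on $W$ (with $[w]_a$ the class of $w$), $L$ assigns to each $a\in Ag$ a function $\mathbb{L}_a:W\to\mathbb{Q}^+$ such that $\sum_{u\in[w]_a}\mathbb{L}_a(u)<\infty$ for all $a,w$, and $V:P\to\mathcal{P}(W)$. For $S\subseteq W$, $\mathbb{L}_a(S)=\sum_{u\in S}\mathbb{L}_a(u)$. Truth: $\top$ always true, $p$ true at $w$ iff $w\in V(p)$, Booleans as usual, and $\mathfrak{M},w\vDash B_a(\phi,\psi)$ iff $\mathbb{L}_a([w]_a\cap\llbracket\phi\wedge\psi\rrbracket_{\mathfrak{M}})>\mathbb{L}_a([w]_a\cap\llbracket\phi\wedge\neg\psi\rrbracket_{\mathfrak{M}})$, with $\llbracket\phi\rrbracket_{\mathfrak{M}}=\{v\mid\mathfrak{M},v\vDash\phi\}$. The CN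 calculus has axioms: (Taut) all propositional tautologies; (Dist-K) $K_a(\phi\to\psi)\to K_a\phi\to K_a\psi$; (T) $K_a\phi\to\phi$; (5B) $B_a(\phi,\psi)\to K_aB_a(\phi,\psi)$; (4B) $\neg B_a(\phi,\psi)\to K_a\neg B_a(\phi,\psi)$; (D) $B_a(\phi,\psi)\to\neg B_a(\phi,\neg\psi)$; (EC) $K_a(\phi\leftrightarrow\psi)\to B_a(\phi,\chi)\to B_a(\psi,\chi)$; (M) $K_a(\phi\to\psi)\to B_a(\chi,\phi)\to B_a(\chi,\psi)$; (C) $B_a(\phi,\psi)\to B_a(\phi,\phi\wedge\psi)$; (SC) $\neg B_a(\chi,\neg\phi)\wedge\check K_a(\chi\wedge\neg\phi\wedge\psi)\to B_a(\chi,\phi\vee\psi)$; rules Modus Ponens and (Nec-K): from $\phi$ infer $K_a\phi$. -}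

module Defs where

open import Level using (0ℓ)
open import Data.Nat using (ℕ; suc)
open import Data.Fin using (Fin)
open import Data.Bool using (Bool; true; false; not; _∧_)
open import Data.Rational using (ℚ; 0ℚ; _+_; _<_; _≤_)
open import Data.List using (List; map; foldr)
open import Data.List.Relation.Unary.All using (All)
open import Data.List.Relation.Unary.Unique.Propositional using (Unique)
open import Data.Product using (Σ; _×_; ∃; ∃-syntax)
open import Data.Empty using (⊥)
open import Data.Unit using (⊤)
open import Relation.Nullary using (¬_)
open import Relation.Binary.PropositionalEquality using (_≡_)
open import Relation.Binary.Structures using (IsEquivalence)
open import Function.Definitions using (Injective)

data Form (n : ℕ) : Set where
  ⊤'  : Form n
  var : ℕ → Form n
  ¬'_ : Form n → Form n
  _∧'_ : Form n → Form n → Form n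
  B   : Fin n → Form n → Form n → Form n

infixr 6 _∧'_
infix 7 ¬'_

module _ {n : ℕ} where
  infixr 5 _∨'_
  infixr 4 _⇒_ _⇔_

  ⊥' : Form n
  ⊥' = ¬' ⊤'

  _∨'_ : Form n → Form n → Form n
  φ ∨' ψ = ¬' (¬' φ ∧' ¬' ψ)

  _⇒_ : Form n → Form n → Form n
  φ ⇒ ψ = ¬' (φ ∧' ¬' ψ)

  _⇔_ : Form n → Form n → Form n
  φ ⇔ ψ = (φ ⇒ ψ) ∧' (ψ ⇒ φ)

  K : Fin n → Form n → Form n
  K a φ = ¬' B a (¬' φ) ⊤'

  Ǩ : Fin n → Form n → Form n
  Ǩ a φ = ¬' K a (¬' φ)

data PForm : Set where
  pvar : ℕ → PForm
  p⊤   : PForm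
  p¬   : PForm → PForm
  p∧   : PForm → PForm → PForm

evalB : (ℕ → Bool) → PForm → Bool
evalB v (pvar i) = v i
evalB v p⊤ = true
evalB v (p¬ t) = not (evalB v t)
evalB v (p∧ t u) = evalB v t ∧ evalB v u

Tautology : PForm → Set
Tautology t = (v : ℕ → Bool) → evalB v t ≡ true

subst : {n : ℕ} → (ℕ → Form n) → PForm → Form n
subst σ (pvar i) = σ i
subst σ p⊤ = ⊤'
subst σ (p¬ t) = ¬' subst σ t
subst σ (p∧ t u) = subst σ t ∧' subst σ u

data ⊢_ {n : ℕ} : Form n → Set where
  Taut  : (t : PForm) → Tautology t → (σ : ℕ → Form n) → ⊢ subst σ t
  DistK : ∀ a φ ψ → ⊢ (K a (φ ⇒ ψ) ⇒ K a φ ⇒ K a ψ)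
  AxT   : ∀ a φ → ⊢ (K a φ ⇒ φ)
  Ax5B  : ∀ a φ ψ → ⊢ (B a φ ψ ⇒ K a (B a φ ψ))
  Ax4B  : ∀ a φ ψ → ⊢ (¬' B a φ ψ ⇒ K a (¬' B a φ ψ))
  AxD   : ∀ a φ ψ → ⊢ (B a φ ψ ⇒ ¬' B a φ (¬' ψ))
  AxEC  : ∀ a φ ψ χ → ⊢ (K a (φ ⇔ ψ) ⇒ B a φ χ ⇒ B a ψ χ)
  AxM   : ∀ a φ ψ χ → ⊢ (K a (φ ⇒ ψ) ⇒ B a χ φ ⇒ B a χ ψ)
  AxC   : ∀ a φ ψ → ⊢ (B a φ ψ ⇒ B a φ (φ ∧' ψ))
  AxSC  : ∀ a φ ψ χ →
          ⊢ ((¬' B a χ (¬' φ) ∧' Ǩ a (χ ∧' ¬' φ ∧' ψ)) ⇒ B a χ (φ ∨' ψ))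
  MP    : ∀ {φ ψ} → ⊢ (φ ⇒ ψ) → ⊢ φ → ⊢ ψ
  NecK  : ∀ a {φ} → ⊢ φ → ⊢ K a φ

record Model (n : ℕ) : Set₁ where
  field
    W        : Set
    w₀       : W                                  -- non-empty
    code     : W → ℕ                              -- countable
    code-inj : Injective _≡_ _≡_ code
    _∼[_]_   : W → Fin n → W → Set
    ∼-equiv  : (a : Fin n) → IsEquivalence (λ u v → u ∼[ a ] v)
    weight   : Fin n → W → ℚ
    weight-pos : ∀ a u → 0ℚ < weight a u
    V        : ℕ → W → Set

  Σw : Fin n → List W → ℚ
  Σw a ws = foldr _+_ 0ℚ (map (weight a) ws)

  -- finite subsets of S ⊆ W: duplicate-free lists of elements of S
  FinSub : (W → Set) → List W → Set
  FinSub S ws = Unique ws × All S ws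

  field
    -- Σ_{u ∈ [w]_a} 𝕃_a(u) < ∞ : finite partial sums are bounded
    summable : ∀ a w → ∃[ b ] ∀ ws → FinSub (λ u → w ∼[ a ] u) ws → Σw a ws ≤ b

  -- 𝕃_a(S₁) > 𝕃_a(S₂) for (summable) S₁, S₂, where 𝕃_a(S) is the
  -- supremum of finite partial sums; expressed without reals.
  WGt : Fin n → (W → Set) → (W → Set) → Set
  WGt a S₁ S₂ = ∃[ F ] FinSub S₁ F × ∃[ ε ] (0ℚ < ε ×
                  (∀ G → FinSub S₂ G → Σw a G + ε ≤ Σw a F))

open Model public

_,_⊨_ : {n : ℕ} (M : Model n) → W M → Form n → Set
M , w ⊨ ⊤' = ⊤
M , w ⊨ var p = V M p w
M , w ⊨ (¬' φ) = ¬ (M , w ⊨ φ)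
M , w ⊨ (φ ∧' ψ) = (M , w ⊨ φ) × (M , w ⊨ ψ)
M , w ⊨ B a φ ψ =
  WGt M a (λ u → _∼[_]_ M w a u × (M , u ⊨ φ) × (M , u ⊨ ψ))
          (λ u → _∼[_]_ M w a u × (M , u ⊨ φ) × ¬ (M , u ⊨ ψ))

Valid : {n : ℕ} → Form n → Set₁
Valid {n} φ = (M : Model n) (w : W M) → M , w ⊨ φ

-- The formula B(p,q) ∧ B(¬p,q) → B(⊤,q) is valid because weights are additive: a finite set of
-- ¬q-worlds splits along p (deciding p is where excluded middle is used), and the two margins add up.  The CN axioms, in contrast, only ever
-- compare weights of sets related by inclusion, so they stay sound when the weight of a set is
-- replaced by an arbitrary strictly monotone set function μ on a single cluster of worlds.  A
-- strictly monotone but superadditive μ on four worlds then refutes the formula.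
module Submission where

open import Defs
open import Level using (0ℓ)
open import Data.Nat using (ℕ; suc)
open import Data.Fin using (Fin; zero)
open import Data.Product using (Σ; _×_; _,_)
open import Relation.Nullary using (¬_)
open import Axiom.ExcludedMiddle using (ExcludedMiddle)

additivity : (n : ℕ) → Form (suc n)
additivity n = (B zero p q ∧' B zero (¬' p) q) ⇒ B zero ⊤' q
  where
  p q : Form (suc n)
  p = var 0
  q = var 1

module WeightModels {n : ℕ} (M : Model n) (a : Fin n) where
  open import Data.Rational using (_+_; _≤_)
  open import Data.Rational.Properties
    using (+-assoc; +-identityˡ; +-mono-≤; +-mono-<; +-0-commutativeMonoid; module ≤-Reasoning)
  open import Algebra.Bundles using (CommutativeMonoid)
  open import Algebra.Properties.CommutativeSemigroup
    (CommutativeMonoid.commutativeSemigroup +-0-commutativeMonoid) using (interchange; x∙yz≈y∙xz)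
  open import Data.List using (List; []; _∷_; _++_; filter)
  import Data.List.Relation.Unary.All as All
  import Data.List.Relation.Unary.All.Properties as All
  import Data.List.Relation.Unary.Unique.Propositional.Properties as Unique
  open import Data.List.Membership.Propositional using (_∈_)
  open import Data.Product using (proj₁)
  open import Relation.Nullary using (yes; no)
  open import Relation.Unary using (Pred; _⊆_; _∩_; ∁; Decidable)
  open import Relation.Unary.Properties using (∁?)
  open import Relation.Binary.PropositionalEquality using (_≡_; sym; trans; cong)

  private variable
    P S₁ S₂ T₁ T₂ : Pred (W M) 0ℓ
    ws : List (W M)

  Σw-++ : ∀ xs ys → Σw M a (xs ++ ys) ≡ Σw M a xs + Σw M a ys
  Σw-++ []       ys = sym (+-identityˡ _)
  Σw-++ (x ∷ xs) ys =
    trans (cong (weight M a x +_) (Σw-++ xs ys)) (sym (+-assoc (weight M a x) (Σw M a xs) (Σw M a ys)))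

  Σw-partition : (P? : Decidable P) (xs : List (W M)) →
                 Σw M a (filter P? xs) + Σw M a (filter (∁? P?) xs) ≡ Σw M a xs
  Σw-partition P? []       = +-identityˡ _
  Σw-partition P? (x ∷ xs) with P? x
  ... | yes _ = trans (+-assoc (weight M a x) _ _) (cong (weight M a x +_) (Σw-partition P? xs))
  ... | no _  = trans (x∙yz≈y∙xz (Σw M a (filter P? xs)) (weight M a x) (Σw M a (filter (∁? P?) xs)))
                       (cong (weight M a x +_) (Σw-partition P? xs))

  FinSub-mono : S₁ ⊆ T₁ → FinSub M S₁ ws → FinSub M T₁ ws
  FinSub-mono S₁⊆T₁ (unique , all) = unique , All.map S₁⊆T₁ all

  FinSub-filter : (P? : Decidable P) → FinSub M S₁ ws → FinSub M (S₁ ∩ P) (filter P? ws)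
  FinSub-filter {ws = ws} P? (unique , all) =
    Unique.filter⁺ P? unique , All.zip (All.filter⁺ P? all , All.all-filter P? ws)

  WGt-mono : S₁ ⊆ T₁ → T₂ ⊆ S₂ → WGt M a S₁ S₂ → WGt M a T₁ T₂
  WGt-mono S₁⊆T₁ T₂⊆S₂ (F , F⊆S₁ , ε , ε>0 , bound) =
    F , FinSub-mono S₁⊆T₁ F⊆S₁ , ε , ε>0 , λ G G⊆T₂ → bound G (FinSub-mono T₂⊆S₂ G⊆T₂)

  WGt-split : Decidable P →
              WGt M a (S₁ ∩ P) (S₂ ∩ P) → WGt M a (S₁ ∩ ∁ P) (S₂ ∩ ∁ P) → WGt M a S₁ S₂
  WGt-split {S₂ = S₂} P? (F₁ , (u₁ , F₁⊆S₁∩P) , ε₁ , ε₁>0 , bound₁)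
                         (F₂ , (u₂ , F₂⊆S₁∩∁P) , ε₂ , ε₂>0 , bound₂) =
    F₁ ++ F₂ , (Unique.++⁺ u₁ u₂ disjoint , All.++⁺ (All.map proj₁ F₁⊆S₁∩P) (All.map proj₁ F₂⊆S₁∩∁P)) ,
    ε₁ + ε₂ , +-mono-< ε₁>0 ε₂>0 , bound
    where
    disjoint : ∀ {v} → ¬ (v ∈ F₁ × v ∈ F₂)
    disjoint (v∈F₁ , v∈F₂) with All.lookup F₁⊆S₁∩P v∈F₁ | All.lookup F₂⊆S₁∩∁P v∈F₂
    ... | _ , p | _ , ¬p = ¬p p

    bound : ∀ G → FinSub M S₂ G → Σw M a G + (ε₁ + ε₂) ≤ Σw M a (F₁ ++ F₂)
    bound G G⊆S₂ = begin
      Σw M a G + (ε₁ + ε₂)                    ≡⟨ cong (_+ (ε₁ + ε₂)) (Σw-partition P? G) ⟨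
      (Σw M a G₁ + Σw M a G₂) + (ε₁ + ε₂)     ≡⟨ interchange (Σw M a G₁) (Σw M a G₂) ε₁ ε₂ ⟩
      (Σw M a G₁ + ε₁) + (Σw M a G₂ + ε₂)     ≤⟨ +-mono-≤ (bound₁ G₁ (FinSub-filter P? G⊆S₂))
                                                          (bound₂ G₂ (FinSub-filter (∁? P?) G⊆S₂)) ⟩
      Σw M a F₁ + Σw M a F₂                   ≡⟨ Σw-++ F₁ F₂ ⟨
      Σw M a (F₁ ++ F₂)                       ∎
      where
      open ≤-Reasoning
      G₁ = filter P? G
      G₂ = filter (∁? P?) G

additivity-valid : (n : ℕ) → ExcludedMiddle 0ℓ → Valid (additivity n)
additivity-valid n em M w ((likely-p , likely-¬p) , ¬likely) =
  ¬likely (WGt-split (λ _ → em)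
    (WGt-mono (λ (r , p , q) → (r , _ , q) , p) (λ ((r , _ , ¬q) , p) → r , p , ¬q) likely-p)
    (WGt-mono (λ (r , p , q) → (r , _ , q) , p) (λ ((r , _ , ¬q) , p) → r , p , ¬q) likely-¬p))
  where open WeightModels M zero

module CapacitySemantics where
  open import Data.Nat using (_+_; _*_; _≤_; _<_; _<?_)
  open import Data.Nat.Properties
    using (<⇒≤; ≤-reflexive; <-asym; ≮⇒≥; <⇒≱; +-mono-<-≤; *-monoʳ-≤; *-mono-≤; module ≤-Reasoning)
  open import Data.Bool using (not; _∧_)
  open import Data.Vec using ([]; _∷_; lookup)
  open import Data.Vec.Properties using (lookup-map; lookup-zipWith; lookup-replicate; lookup⇒[]=)
  open import Data.Fin.Subset
    using (Subset; inside; outside; _∈_; _∉_; _⊆_; _⊂_; ∁; _∩_; ⊤; ⊥; ∣_∣; Nonempty)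
  open import Data.Fin.Subset.Properties
    using ( _∈?_; _⊂?_; nonempty?; ∈⊤; ∉⊥; x∈p∩q⁺; x∈p∩q⁻; x∈∁p⇒x∉p; x∉p⇒x∈∁p; x∉∁p⇒x∈p
          ; ⊆-antisym; p∩q⊆p; p⊆q⇒∁p⊇∁q; p⊂q⇒p⊆q; p⊆q⇒∣p∣≤∣q∣; p⊂q⇒∣p∣<∣q∣; ∪-∩-booleanAlgebra)
  import Algebra.Lattice.Properties.BooleanAlgebra as BooleanAlgebra
  open import Relation.Nullary using (Dec; yes; no; contradiction)
  open import Relation.Nullary.Decidable using (decidable-stable)
  open import Relation.Binary.PropositionalEquality
    using (_≡_; refl; sym; trans; cong; cong₂) renaming (subst to ≡-subst)
  open import Data.Product using (proj₁; proj₂)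

  private variable
    k : ℕ
    p q r : Subset k
    x y : Fin k

  ∁-involutive : (p : Subset k) → ∁ (∁ p) ≡ p
  ∁-involutive {k} = BooleanAlgebra.¬-involutive (∪-∩-booleanAlgebra k)

  ∩-monoˡ-⊆ : p ⊆ q → p ∩ r ⊆ q ∩ r
  ∩-monoˡ-⊆ {p = p} {r = r} p⊆q x∈p∩r with x∈p∩q⁻ p r x∈p∩r
  ... | x∈p , x∈r = x∈p∩q⁺ (p⊆q x∈p , x∈r)

  ∩-monoʳ-⊆ : q ⊆ r → p ∩ q ⊆ p ∩ r
  ∩-monoʳ-⊆ {q = q} {p = p} q⊆r x∈p∩q with x∈p∩q⁻ p q x∈p∩q
  ... | x∈p , x∈q = x∈p∩q⁺ (x∈p , q⊆r x∈q)

  ∈-⇒⁺ : (x ∈ p → x ∈ q) → x ∈ ∁ (p ∩ ∁ q)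
  ∈-⇒⁺ {p = p} {q = q} f = x∉p⇒x∈∁p λ x∈p∩∁q → let x∈p , x∈∁q = x∈p∩q⁻ p (∁ q) x∈p∩∁q in x∈∁p⇒x∉p x∈∁q (f x∈p)

  ∈-⇒⁻ : x ∈ ∁ (p ∩ ∁ q) → x ∈ p → x ∈ q
  ∈-⇒⁻ x∈p⇒q x∈p = x∉∁p⇒x∈p λ x∈∁q → x∈∁p⇒x∉p x∈p⇒q (x∈p∩q⁺ (x∈p , x∈∁q))

  fullIf : {P : Set} → Dec P → Subset k
  fullIf (yes _) = ⊤
  fullIf (no _)  = ⊥

  module _ {P : Set} where
    ∈-fullIf⁺ : (d : Dec P) → P → x ∈ fullIf d
    ∈-fullIf⁺ (yes _) _ = ∈⊤
    ∈-fullIf⁺ (no ¬P) P = contradiction P ¬P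

    ∈-fullIf⁻ : (d : Dec P) → x ∈ fullIf {k} d → P
    ∈-fullIf⁻ (yes P) _   = P
    ∈-fullIf⁻ (no _) x∈⊥ = contradiction x∈⊥ ∉⊥

  module _ {m : ℕ} (μ : Subset m → ℕ) (μ-strict : ∀ {p q} → p ⊂ q → μ p < μ q) where
    open ≤-Reasoning

    μ-mono : p ⊆ q → μ p ≤ μ q
    μ-mono {p} {q} p⊆q with p ⊂? q
    ... | yes p⊂q = <⇒≤ (μ-strict p⊂q)
    ... | no  p⊄q = ≤-reflexive (cong μ (⊆-antisym p⊆q q⊆p))
      where
      q⊆p : q ⊆ p
      q⊆p {x} x∈q = decidable-stable (x ∈? p) λ x∉p → p⊄q (p⊆q , x , x∈q , x∉p)

    Likely : Subset m → Subset m → Set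
    Likely p q = μ (p ∩ ∁ q) < μ (p ∩ q)

    likely? : ∀ p q → Dec (Likely p q)
    likely? p q = μ (p ∩ ∁ q) <? μ (p ∩ q)

    Nonempty⇒Likely-⊤ : Nonempty p → Likely p ⊤
    Nonempty⇒Likely-⊤ {p} (x , x∈p) = μ-strict (p∩∁⊤⊆p∩⊤ , x , x∈p∩q⁺ (x∈p , ∈⊤) , x∉p∩∁⊤)
      where
      x∉p∩∁⊤ : ∀ {y} → y ∉ p ∩ ∁ ⊤
      x∉p∩∁⊤ y∈p∩∁⊤ = x∈∁p⇒x∉p (proj₂ (x∈p∩q⁻ p (∁ ⊤) y∈p∩∁⊤)) ∈⊤
      p∩∁⊤⊆p∩⊤ : p ∩ ∁ ⊤ ⊆ p ∩ ⊤
      p∩∁⊤⊆p∩⊤ y∈p∩∁⊤ = contradiction y∈p∩∁⊤ x∉p∩∁⊤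

    Likely-⊤⇒Nonempty : Likely p ⊤ → Nonempty p
    Likely-⊤⇒Nonempty {p} likely = decidable-stable (nonempty? p) λ empty →
      <⇒≱ likely (μ-mono λ {x} x∈p∩⊤ → contradiction (x , proj₁ (x∈p∩q⁻ p ⊤ x∈p∩⊤)) empty)

    Likely-asym : Likely p q → ¬ Likely p (∁ q)
    Likely-asym {p} {q} likely likely∁ =
      <-asym likely (≡-subst (λ r → μ (p ∩ r) < μ (p ∩ ∁ q)) (∁-involutive q) likely∁)

    Likely-monoʳ : q ⊆ r → Likely p q → Likely p r
    Likely-monoʳ {q} {r} {p} q⊆r likely = begin-strict
      μ (p ∩ ∁ r) ≤⟨ μ-mono (∩-monoʳ-⊆ (p⊆q⇒∁p⊇∁q q⊆r)) ⟩
      μ (p ∩ ∁ q) <⟨ likely ⟩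
      μ (p ∩ q)   ≤⟨ μ-mono (∩-monoʳ-⊆ q⊆r) ⟩
      μ (p ∩ r)   ∎

    Likely-∩ : Likely p q → Likely p (p ∩ q)
    Likely-∩ {p} {q} likely = begin-strict
      μ (p ∩ ∁ (p ∩ q)) ≤⟨ μ-mono p∩∁[p∩q]⊆p∩∁q ⟩
      μ (p ∩ ∁ q)       <⟨ likely ⟩
      μ (p ∩ q)         ≤⟨ μ-mono (λ x∈p∩q → x∈p∩q⁺ (proj₁ (x∈p∩q⁻ p q x∈p∩q) , x∈p∩q)) ⟩
      μ (p ∩ (p ∩ q))   ∎
      where
      p∩∁[p∩q]⊆p∩∁q : p ∩ ∁ (p ∩ q) ⊆ p ∩ ∁ q
      p∩∁[p∩q]⊆p∩∁q x∈ with x∈p∩q⁻ p (∁ (p ∩ q)) x∈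
      ... | x∈p , x∉p∩q = x∈p∩q⁺ (x∈p , x∉p⇒x∈∁p λ x∈q → x∈∁p⇒x∉p x∉p∩q (x∈p∩q⁺ (x∈p , x∈q)))

    Likely-SC : ¬ Likely p (∁ q) → Nonempty (p ∩ (∁ q ∩ r)) → Likely p (∁ (∁ q ∩ ∁ r))
    Likely-SC {p} {q} {r} unlikely∁ (y , y∈p∩[∁q∩r]) with x∈p∩q⁻ p (∁ q ∩ r) y∈p∩[∁q∩r]
    ... | y∈p , y∈∁q∩r with x∈p∩q⁻ (∁ q) r y∈∁q∩r
    ... | y∈∁q , y∈r =
      ≡-subst (λ s → μ (p ∩ s) < μ (p ∩ ∁ (∁ q ∩ ∁ r))) (sym (∁-involutive (∁ q ∩ ∁ r))) (begin-strict
        μ (p ∩ (∁ q ∩ ∁ r))   <⟨ μ-strict p∩[∁q∩∁r]⊂p∩∁q ⟩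
        μ (p ∩ ∁ q)           ≤⟨ ≡-subst (λ s → μ (p ∩ ∁ q) ≤ μ (p ∩ s)) (∁-involutive q) (≮⇒≥ unlikely∁) ⟩
        μ (p ∩ q)             ≤⟨ μ-mono (∩-monoʳ-⊆ q⊆∁[∁q∩∁r]) ⟩
        μ (p ∩ ∁ (∁ q ∩ ∁ r)) ∎)
      where
      y∉p∩[∁q∩∁r] : y ∉ p ∩ (∁ q ∩ ∁ r)
      y∉p∩[∁q∩∁r] y∈ = x∈∁p⇒x∉p (proj₂ (x∈p∩q⁻ (∁ q) (∁ r) (proj₂ (x∈p∩q⁻ p _ y∈)))) y∈r

      p∩[∁q∩∁r]⊂p∩∁q : p ∩ (∁ q ∩ ∁ r) ⊂ p ∩ ∁ q
      p∩[∁q∩∁r]⊂p∩∁q = ∩-monoʳ-⊆ (p∩q⊆p (∁ q) (∁ r)) , y , x∈p∩q⁺ (y∈p , y∈∁q) , y∉p∩[∁q∩∁r]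

      q⊆∁[∁q∩∁r] : q ⊆ ∁ (∁ q ∩ ∁ r)
      q⊆∁[∁q∩∁r] x∈q = x∉p⇒x∈∁p λ x∈∁q∩∁r → x∈∁p⇒x∉p (proj₁ (x∈p∩q⁻ (∁ q) (∁ r) x∈∁q∩∁r)) x∈q

    -- All agents share a single equivalence class, the whole of Fin m, so belief formulas
    -- are true everywhere or nowhere.
    module Semantics (val : ℕ → Subset m) where
      ⟦_⟧ : ∀ {n} → Form n → Subset m
      ⟦ ⊤' ⟧      = ⊤
      ⟦ var i ⟧   = val i
      ⟦ ¬' φ ⟧    = ∁ ⟦ φ ⟧
      ⟦ φ ∧' ψ ⟧  = ⟦ φ ⟧ ∩ ⟦ ψ ⟧
      ⟦ B _ φ ψ ⟧ = fullIf (likely? ⟦ φ ⟧ ⟦ ψ ⟧)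

      Holds : ∀ {n} → Form n → Set
      Holds φ = ∀ x → x ∈ ⟦ φ ⟧

      private variable
        n : ℕ
        φ : Form n

      ∈-B⁺ : (a : Fin n) (φ ψ : Form n) → Likely ⟦ φ ⟧ ⟦ ψ ⟧ → x ∈ ⟦ B a φ ψ ⟧
      ∈-B⁺ a φ ψ = ∈-fullIf⁺ (likely? ⟦ φ ⟧ ⟦ ψ ⟧)

      ∈-B⁻ : (a : Fin n) (φ ψ : Form n) → x ∈ ⟦ B a φ ψ ⟧ → Likely ⟦ φ ⟧ ⟦ ψ ⟧
      ∈-B⁻ a φ ψ = ∈-fullIf⁻ (likely? ⟦ φ ⟧ ⟦ ψ ⟧)

      ∈-K⁺ : (a : Fin n) (φ : Form n) → (∀ y → y ∈ ⟦ φ ⟧) → x ∈ ⟦ K a φ ⟧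
      ∈-K⁺ a φ φ-everywhere = x∉p⇒x∈∁p λ likely →
        let y , y∈∁φ = Likely-⊤⇒Nonempty (∈-fullIf⁻ (likely? (∁ ⟦ φ ⟧) ⊤) likely)
        in x∈∁p⇒x∉p y∈∁φ (φ-everywhere y)

      ∈-K⁻ : (a : Fin n) (φ : Form n) → x ∈ ⟦ K a φ ⟧ → ∀ y → y ∈ ⟦ φ ⟧
      ∈-K⁻ a φ known y = x∉∁p⇒x∈p λ y∈∁φ →
        x∈∁p⇒x∉p known (∈-fullIf⁺ (likely? (∁ ⟦ φ ⟧) ⊤) (Nonempty⇒Likely-⊤ (y , y∈∁φ)))

      ∈-Ǩ⁻ : (a : Fin n) (φ : Form n) → x ∈ ⟦ Ǩ a φ ⟧ → Nonempty ⟦ φ ⟧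
      ∈-Ǩ⁻ a φ possible = decidable-stable (nonempty? ⟦ φ ⟧) λ empty →
        x∈∁p⇒x∉p possible (∈-K⁺ a (¬' φ) λ y → x∉p⇒x∈∁p λ y∈φ → empty (y , y∈φ))

      K⇒-⊆ : (a : Fin n) (φ ψ : Form n) → x ∈ ⟦ K a (φ ⇒ ψ) ⟧ → ⟦ φ ⟧ ⊆ ⟦ ψ ⟧
      K⇒-⊆ a φ ψ known {y} = ∈-⇒⁻ (∈-K⁻ a (φ ⇒ ψ) known y)

      K⇔-≡ : (a : Fin n) (φ ψ : Form n) → x ∈ ⟦ K a (φ ⇔ ψ) ⟧ → ⟦ φ ⟧ ≡ ⟦ ψ ⟧
      K⇔-≡ a φ ψ known = ⊆-antisym
        (λ {y} → ∈-⇒⁻ (proj₁ (x∈p∩q⁻ ⟦ φ ⇒ ψ ⟧ ⟦ ψ ⇒ φ ⟧ (∈-K⁻ a (φ ⇔ ψ) known y))))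
        (λ {y} → ∈-⇒⁻ (proj₂ (x∈p∩q⁻ ⟦ φ ⇒ ψ ⟧ ⟦ ψ ⇒ φ ⟧ (∈-K⁻ a (φ ⇔ ψ) known y))))

      lookup-subst : (σ : ℕ → Form n) (t : PForm) (x : Fin m) →
                     lookup ⟦ subst σ t ⟧ x ≡ evalB (λ i → lookup ⟦ σ i ⟧ x) t
      lookup-subst σ (pvar i) x = refl
      lookup-subst σ p⊤       x = lookup-replicate x inside
      lookup-subst σ (p¬ t)   x = trans (lookup-map x not ⟦ subst σ t ⟧) (cong not (lookup-subst σ t x))
      lookup-subst σ (p∧ t u) x = trans (lookup-zipWith _∧_ x ⟦ subst σ t ⟧ ⟦ subst σ u ⟧)
                                        (cong₂ _∧_ (lookup-subst σ t x) (lookup-subst σ u x))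

      sound : ⊢ φ → Holds φ
      sound (Taut t tautology σ) x = lookup⇒[]= x _ (trans (lookup-subst σ t x) (tautology _))
      sound (DistK a φ ψ) x = ∈-⇒⁺ λ k₁ → ∈-⇒⁺ λ k₂ → ∈-K⁺ a ψ λ y →
        ∈-⇒⁻ (∈-K⁻ a (φ ⇒ ψ) k₁ y) (∈-K⁻ a φ k₂ y)
      sound (AxT a φ) x = ∈-⇒⁺ λ known → ∈-K⁻ a φ known x
      sound (Ax5B a φ ψ) x = ∈-⇒⁺ λ b → ∈-K⁺ a (B a φ ψ) λ _ → ∈-B⁺ a φ ψ (∈-B⁻ a φ ψ b)
      sound (Ax4B a φ ψ) x = ∈-⇒⁺ λ ¬b → ∈-K⁺ a (¬' B a φ ψ) λ _ →
        x∉p⇒x∈∁p λ b → x∈∁p⇒x∉p ¬b (∈-B⁺ a φ ψ (∈-B⁻ a φ ψ b))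
      sound (AxD a φ ψ) x = ∈-⇒⁺ λ b → x∉p⇒x∈∁p λ b∁ → Likely-asym (∈-B⁻ a φ ψ b) (∈-B⁻ a φ (¬' ψ) b∁)
      sound (AxEC a φ ψ χ) x = ∈-⇒⁺ λ k → ∈-⇒⁺ λ b →
        ∈-B⁺ a ψ χ (≡-subst (λ p → Likely p ⟦ χ ⟧) (K⇔-≡ a φ ψ k) (∈-B⁻ a φ χ b))
      sound (AxM a φ ψ χ) x = ∈-⇒⁺ λ k → ∈-⇒⁺ λ b →
        ∈-B⁺ a χ ψ (Likely-monoʳ (K⇒-⊆ a φ ψ k) (∈-B⁻ a χ φ b))
      sound (AxC a φ ψ) x = ∈-⇒⁺ λ b → ∈-B⁺ a φ (φ ∧' ψ) (Likely-∩ (∈-B⁻ a φ ψ b))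
      sound (AxSC a φ ψ χ) x = ∈-⇒⁺ λ h →
        let ¬b , ǩ = x∈p∩q⁻ ⟦ ¬' B a χ (¬' φ) ⟧ ⟦ Ǩ a (χ ∧' ¬' φ ∧' ψ) ⟧ h
        in ∈-B⁺ a χ (φ ∨' ψ)
             (Likely-SC (λ l → x∈∁p⇒x∉p ¬b (∈-B⁺ a χ (¬' φ) l)) (∈-Ǩ⁻ a (χ ∧' ¬' φ ∧' ψ) ǩ))
      sound (MP d e) x = ∈-⇒⁻ (sound d x) (sound e x)
      sound (NecK a {φ} d) x = ∈-K⁺ a φ (sound d)

  E O : Subset 4
  E = inside ∷ outside ∷ inside ∷ outside ∷ []
  O = ∁ E

  -- Each point of E outweighs each point of O (3 against 2), but O weighs as much as E (6 each).
  μ₄ : Subset 4 → ℕ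
  μ₄ p = ∣ p ∣ + 2 * ∣ p ∩ E ∣ + ∣ p ∩ O ∣ * ∣ p ∩ O ∣

  μ₄-strict : p ⊂ q → μ₄ p < μ₄ q
  μ₄-strict {p = p} {q = q} p⊂q =
    +-mono-<-≤ (+-mono-<-≤ (p⊂q⇒∣p∣<∣q∣ p⊂q) (*-monoʳ-≤ 2 (∣∩∣-mono E)))
               (*-mono-≤ (∣∩∣-mono O) (∣∩∣-mono O))
    where
    ∣∩∣-mono : ∀ r → ∣ p ∩ r ∣ ≤ ∣ q ∩ r ∣
    ∣∩∣-mono r = p⊆q⇒∣p∣≤∣q∣ (∩-monoˡ-⊆ (p⊂q⇒p⊆q p⊂q))

  -- With p = var 0 and q = var 1, the cells p ∩ q, p ∩ ¬q, ¬p ∩ q, ¬p ∩ ¬q are the points 0, 1, 2, 3.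
  val₄ : ℕ → Subset 4
  val₄ 0 = inside ∷ inside ∷ outside ∷ outside ∷ []
  val₄ _ = E

  open Semantics μ₄ μ₄-strict val₄

  additivity-unprovable : (n : ℕ) → ¬ ⊢ additivity n
  additivity-unprovable n ⊢additivity with sound ⊢additivity zero
  ... | ()

theorem3 : (n : ℕ) → ExcludedMiddle 0ℓ →
    Σ (Form (suc n)) (λ φ → Valid φ × ¬ (⊢ φ))
theorem3 n em = additivity n , additivity-valid n em , CapacitySemantics.additivity-unprovable n
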